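{- Let $\mathfrak a_{n,m,d}$ be the number of $\sigma\in\mathcal{I}_n(010)$ with $\max(\sigma)=m$ and exactly $d$ distinct values. Let $\mathfrak b_{n,k}$ be the number of words $\omega$ of length $n$ over $\{0,\dots,k-1\}$ avoiding $010$, in which every letter of $\{0,\dots,k-1\}$ appears at least once, and with $\omega_1=k-1$. Then for all integers $2\leqslant d\leqslant m+1\leqslant n$, $$\mathfrak a_{n,m,d}=\sum_{i=0}^{d-1}\binom{m-i}{d-i-1}\sum_{p=m+1}^{n}\mathfrak b_{n-p+1,d-i}\sum_{j=0}^{m-1}\mathfrak a_{p-1,j,i}.$$
   Context: For $n\in\mathbb N$, an inversion sequence of size $n$ is a sequence $\sigma=(\sigma_1,\dots,\sigma_n)\in\mathbb N^n$ with $\sigma_i<i$ for all $i$. An integer sequence contains a pattern $\rho$ (a finite integer sequence such as $010$) if it has a subsequence order-isomorphic to $\rho$, and avoids $\rho$ otherwise. $\mathcal{I}_n(P)$ denotes the set of inversion sequences of size $n$ avoiding every pattern in $P$. $\max(\sigma)$ is the largest entry of $\sigma$; for the empty sequence, $\max=-1$ and the number of distinct values is $0$. -}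

module Defs where

open import Data.Nat using (ℕ; zero; suc; _+_; _∸_; _<_; _⊔_)
open import Data.Nat.Properties using (_≟_; _<?_)
open import Data.Integer as ℤ using (ℤ; +_; -[1+_])
open import Data.List using (List; []; _∷_; _++_; [_]; map; concatMap; upTo; length; filter; deduplicate; foldr)
open import Data.List.Relation.Unary.Any using (Any)
import Data.List.Relation.Unary.Any as Any
open import Data.List.Relation.Unary.All using (All; all?)
open import Data.List.Membership.DecPropositional _≟_ using (_∈_; _∈?_)
open import Data.Nat.ListAction using (sum)
open import Data.Product using (_×_; _,_)
open import Relation.Binary.PropositionalEquality using (_≡_)
open import Relation.Nullary using (Dec; ¬_; ¬?)
open import Relation.Nullary.Decidable using (_×-dec_)

pairsFrom : ℕ → List ℕ → List (ℕ × ℕ × ℕ)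
pairsFrom a [] = []
pairsFrom a (b ∷ s) = map (λ c → (a , b , c)) s ++ pairsFrom a s

subs3 : List ℕ → List (ℕ × ℕ × ℕ)
subs3 [] = []
subs3 (a ∷ s) = pairsFrom a s ++ subs3 s

-- A triple (a,b,c) is order-isomorphic to the pattern 010 iff a = c < b.
Iso010 : ℕ × ℕ × ℕ → Set
Iso010 (a , b , c) = (a ≡ c) × (a < b)

iso010? : (t : ℕ × ℕ × ℕ) → Dec (Iso010 t)
iso010? (a , b , c) = (a ≟ c) ×-dec (a <? b)

Contains010 : List ℕ → Set
Contains010 s = Any Iso010 (subs3 s)

Avoids010 : List ℕ → Set
Avoids010 s = ¬ Contains010 s

avoids010? : (s : List ℕ) → Dec (Avoids010 s)
avoids010? s = ¬? (Any.any? iso010? (subs3 s))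

-- All inversion sequences of size n (σ_i < i, 1-indexed), as lists.
invSeqs : ℕ → List (List ℕ)
invSeqs zero = [] ∷ []
invSeqs (suc n) = concatMap (λ s → map (λ v → s ++ [ v ]) (upTo (suc n))) (invSeqs n)

words : ℕ → ℕ → List (List ℕ)
words k zero = [] ∷ []
words k (suc n) = concatMap (λ w → map (_∷ w) (upTo k)) (words k n)

-- max of a sequence, with max of the empty sequence = -1.
maxSeq : List ℕ → ℤ
maxSeq [] = -[1+ 0 ]
maxSeq (x ∷ s) = + foldr _⊔_ x s

distinct : List ℕ → ℕ
distinct s = length (deduplicate _≟_ s)

aCount : ℕ → ℕ → ℕ → ℕ
aCount n m d = length (filter (λ σ → avoids010? σ ×-dec (maxSeq σ ℤ.≟ + m) ×-dec (distinct σ ≟ d)) (invSeqs n))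

HeadIs : ℕ → List ℕ → Set
HeadIs x [] = ⊥′ where open import Data.Empty renaming (⊥ to ⊥′)
HeadIs x (y ∷ _) = y ≡ x

headIs? : (x : ℕ) (w : List ℕ) → Dec (HeadIs x w)
headIs? x [] = Relation.Nullary.no (λ ())
  where import Relation.Nullary
headIs? x (y ∷ _) = y ≟ x

Surjective : ℕ → List ℕ → Set
Surjective k w = All (λ x → x ∈ w) (upTo k)

surjective? : (k : ℕ) (w : List ℕ) → Dec (Surjective k w)
surjective? k w = all? (λ x → x ∈? w) (upTo k)

bCount : ℕ → ℕ → ℕ
bCount n k = length (filter (λ ω → avoids010? ω ×-dec surjective? k ω ×-dec headIs? (k ∸ 1) ω) (words k n))

-- ∑_{i=lo}^{hi} f i  (empty if hi < lo)
sumFromTo : ℕ → ℕ → (ℕ → ℕ) → ℕ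
sumFromTo lo hi f = sum (map (λ t → f (lo + t)) (upTo (suc hi ∸ lo)))

-- Split σ at the first occurrence of its maximum m, σ = α ++ τ with τ starting with m.
-- A value occurring both in α and in τ would form the pattern 010 with the m between them,
-- so α and τ use disjoint values: α is a 010-avoiding inversion sequence of length p − 1 ≥ m
-- with i distinct values, all below m (maximum j), and the value set of τ is m together with
-- a (d − i − 1)-subset W of the m − i values below m that α leaves unused. Relabelling τ
-- order-preservingly onto {0, …, d − i − 1} turns it into a word ω counted by 𝔟, and τ is
-- recovered from W and ω. Every entry of τ is at most m ≤ p − 1, so gluing α and τ never
-- violates the inversion-sequence condition. Hence σ ↦ (i, p, j, α, W, ω) is a bijection onto
-- the tuples counted by the right-hand side.

module Submission where

open import Defs
open import Data.Nat using (ℕ; zero; suc; _+_; _*_; _∸_; _≤_; _<_; _⊔_; z≤n; s≤s)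
open import Data.Nat.Properties
open import Data.Nat.Combinatorics using (_C_; nCk+nC[k+1]≡[n+1]C[k+1])
open import Data.Nat.ListAction using (sum)
import Data.Integer as ℤ
open import Data.Product using (_×_; _,_; proj₁; proj₂; ∃; ∃₂)
open import Data.Product.Properties using (,-injectiveˡ; ,-injectiveʳ)
open import Data.Sum using (_⊎_; inj₁; inj₂; [_,_]′)
open import Data.Unit using (⊤; tt)
open import Function using (_∘_)
open import Function.Bundles using (mk⇔)
open import Relation.Binary.Definitions using (tri<; tri≈; tri>)
open import Relation.Binary.PropositionalEquality hiding ([_])
open import Relation.Nullary using (¬_; ¬?; yes; no; contradiction)
open import Relation.Nullary.Decidable using (_×-dec_)
open import Relation.Unary using (Decidable)

open import Data.List
  using (List; []; _∷_; _++_; [_]; map; concatMap; upTo; length; filter; deduplicate; foldr; initLast; _∷ʳ′_; break)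
open import Data.List.Properties
  using (length-++; length-map; map-∘; map-id-local; ∷-injectiveʳ; ∷ʳ-injective;
         filter-accept; filter-reject; filter-none; filter-notAll; length-upTo)
open import Data.List.Membership.Propositional using (_∈_; _∉_; find; lose)
open import Data.List.Membership.Propositional.Properties
open import Data.List.Membership.Propositional.Properties.WithK using (unique∧set⇒bag)
open import Data.List.Membership.DecPropositional _≟_ using (_∈?_; _∉?_)
open import Data.List.Relation.Unary.All as All using (All; []; _∷_)
import Data.List.Relation.Unary.All.Properties as All
open import Data.List.Relation.Unary.Any as Any using (here; there)
open import Data.List.Relation.Unary.AllPairs as AllPairs using (AllPairs; []; _∷_)
import Data.List.Relation.Unary.AllPairs.Properties as AllPairsₚ
open import Data.List.Relation.Unary.Unique.Propositional using (Unique)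
import Data.List.Relation.Unary.Unique.Propositional.Properties as Unique
open import Data.List.Relation.Unary.Unique.DecPropositional.Properties _≟_ using (deduplicate-!)
open import Data.List.Relation.Unary.Sorted.TotalOrder ≤-totalOrder using (Sorted)
open import Data.List.Relation.Unary.Sorted.TotalOrder.Properties using (AllPairs⇒Sorted; ↗↭↗⇒≋)
open import Data.List.Relation.Binary.Pointwise using (Pointwise-≡⇒≡)
open import Data.List.Relation.Binary.Disjoint.Propositional using (Disjoint)
open import Data.List.Relation.Binary.BagAndSetEquality using (∼bag⇒↭)
open import Data.List.Relation.Binary.Permutation.Propositional using (_↭_; ↭⇒↭ₛ′)
open import Data.List.Relation.Binary.Permutation.Propositional.Properties using (↭-length)
open import Data.List.Relation.Binary.Sublist.Propositional using (_⊆_; []; _∷_; _∷ʳ_; from∈; ⊆-refl)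
open import Data.List.Relation.Binary.Sublist.Propositional.Properties as Sublist
  using (Any-resp-⊆; ++⁺; ++⁺ˡ; ++⁺ʳ)

private variable
  A B D : Set

≤∸1⇒< : ∀ {k n} → 1 ≤ n → k ≤ n ∸ 1 → k < n
≤∸1⇒< {n = suc n} _ k≤n = s≤s k≤n

<⇒≤∸1 : ∀ {k n} → k < n → k ≤ n ∸ 1
<⇒≤∸1 (s≤s k≤n) = k≤n

[p∸1]+[n∸p+1]≡n : ∀ {p n} → 1 ≤ p → p ≤ n → p ∸ 1 + (n ∸ p + 1) ≡ n
[p∸1]+[n∸p+1]≡n {suc p} {n} _ p<n = begin
  p + (n ∸ suc p + 1)   ≡⟨ cong (p +_) (+-comm (n ∸ suc p) 1) ⟩
  p + suc (n ∸ suc p)   ≡⟨ +-suc p (n ∸ suc p) ⟩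
  suc p + (n ∸ suc p)   ≡⟨ m+[n∸m]≡n p<n ⟩
  n                     ∎
  where open ≡-Reasoning

m+[1+n]∸[m+1]+1≡1+n : ∀ m n → m + suc n ∸ (m + 1) + 1 ≡ suc n
m+[1+n]∸[m+1]+1≡1+n m n = trans (cong (_+ 1) ([m+n]∸[m+o]≡n∸o m (suc n) 1)) (+-comm n 1)

sum-map-cong : ∀ {f g : A → ℕ} xs → (∀ {x} → x ∈ xs → f x ≡ g x) → sum (map f xs) ≡ sum (map g xs)
sum-map-cong [] _ = refl
sum-map-cong (x ∷ xs) f≡g = cong₂ _+_ (f≡g (here refl)) (sum-map-cong xs (f≡g ∘ there))

sum-map-const : (c : ℕ) (xs : List A) → sum (map (λ _ → c) xs) ≡ length xs * c
sum-map-const c [] = refl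
sum-map-const c (x ∷ xs) = cong (c +_) (sum-map-const c xs)

sum-map-*ˡ : (c : ℕ) (f : A → ℕ) (xs : List A) → sum (map (λ x → c * f x) xs) ≡ c * sum (map f xs)
sum-map-*ˡ c f [] = sym (*-zeroʳ c)
sum-map-*ˡ c f (x ∷ xs) = trans (cong (c * f x +_) (sum-map-*ˡ c f xs)) (sym (*-distribˡ-+ c (f x) _))

range : ℕ → ℕ → List ℕ
range lo hi = map (lo +_) (upTo (suc hi ∸ lo))

sumFromTo-range : ∀ lo hi f → sumFromTo lo hi f ≡ sum (map f (range lo hi))
sumFromTo-range lo hi f = cong sum (map-∘ (upTo (suc hi ∸ lo)))

range-unique : ∀ lo hi → Unique (range lo hi)
range-unique lo hi = Unique.map⁺ (+-cancelˡ-≡ lo _ _) (Unique.upTo⁺ _)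

∈-range⁺ : ∀ {lo hi x} → lo ≤ x → x ≤ hi → x ∈ range lo hi
∈-range⁺ {lo} {hi} lo≤x x≤hi = subst (_∈ range lo hi) (m+[n∸m]≡n lo≤x)
  (∈-map⁺ (lo +_) (∈-upTo⁺ (∸-monoˡ-< (s≤s x≤hi) lo≤x)))

∈-range⁻ : ∀ {lo hi x} → x ∈ range lo hi → lo ≤ x × x ≤ hi
∈-range⁻ {lo} {hi} x∈ with t , t∈ , refl ← ∈-map⁻ (lo +_) x∈ =
  m≤m+n lo t ,
  ≤-pred (subst (_≤ suc hi) (trans (+-comm (suc t) lo) (+-suc lo t)) (m≤o∸n⇒m+n≤o (suc t) lo≤1+hi t<))
  where
  t< : t < suc hi ∸ lo
  t< = ∈-upTo⁻ t∈
  lo≤1+hi : lo ≤ suc hi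
  lo≤1+hi = <⇒≤ (m∸n≢0⇒n<m (m<n⇒n≢0 t<))

unique∧same-elements⇒↭ : {xs ys : List A} → Unique xs → Unique ys →
  (∀ {x} → x ∈ xs → x ∈ ys) → (∀ {x} → x ∈ ys → x ∈ xs) → xs ↭ ys
unique∧same-elements⇒↭ xs! ys! xs⊆ys ys⊆xs = ∼bag⇒↭ (unique∧set⇒bag xs! ys! (mk⇔ xs⊆ys ys⊆xs))

length-≡-by-inverses : {xs : List A} {ys : List B} → Unique xs → Unique ys →
  (f : A → B) (g : B → A) →
  (∀ {x} → x ∈ xs → f x ∈ ys × g (f x) ≡ x) →
  (∀ {y} → y ∈ ys → g y ∈ xs × f (g y) ≡ y) →
  length xs ≡ length ys
length-≡-by-inverses {xs = xs} {ys} xs! ys! f g to from = begin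
  length xs          ≡⟨ length-map f xs ⟨
  length (map f xs)  ≡⟨ ↭-length (unique∧same-elements⇒↭ fxs! ys! fxs⊆ys ys⊆fxs) ⟩
  length ys          ∎
  where
  open ≡-Reasoning
  g∘f≡id : map g (map f xs) ≡ xs
  g∘f≡id = trans (sym (map-∘ xs)) (map-id-local (All.tabulate (proj₂ ∘ to)))
  fxs! : Unique (map f xs)
  fxs! = Unique.map⁻ (subst Unique (sym g∘f≡id) xs!)
  fxs⊆ys : ∀ {y} → y ∈ map f xs → y ∈ ys
  fxs⊆ys y∈ with x , x∈ , refl ← ∈-map⁻ f y∈ = proj₁ (to x∈)
  ys⊆fxs : ∀ {y} → y ∈ ys → y ∈ map f xs
  ys⊆fxs y∈ = subst (_∈ map f xs) (proj₂ (from y∈)) (∈-map⁺ f (proj₁ (from y∈)))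

length-filter+length-filter-∁ : ∀ {P : A → Set} (P? : Decidable P) xs →
  length (filter P? xs) + length (filter (¬? ∘ P?) xs) ≡ length xs
length-filter+length-filter-∁ P? [] = refl
length-filter+length-filter-∁ P? (x ∷ xs) with P? x
... | yes _ = cong suc (length-filter+length-filter-∁ P? xs)
... | no _ = trans (+-suc _ _) (cong suc (length-filter+length-filter-∁ P? xs))

concatMap₂ : (A → B → D) → (A → List B) → List A → List D
concatMap₂ h g = concatMap (λ x → map (h x) (g x))

module _ (h : A → B → D) (g : A → List B) where

  ∈-concatMap₂⁺ : ∀ {xs x y} → x ∈ xs → y ∈ g x → h x y ∈ concatMap₂ h g xs
  ∈-concatMap₂⁺ {x ∷ xs} (here refl) y∈ = ∈-++⁺ˡ (∈-map⁺ (h x) y∈)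
  ∈-concatMap₂⁺ {x ∷ xs} (there x∈) y∈ = ∈-++⁺ʳ (map (h x) (g x)) (∈-concatMap₂⁺ x∈ y∈)

  ∈-concatMap₂⁻ : ∀ {xs z} → z ∈ concatMap₂ h g xs → ∃₂ λ x y → x ∈ xs × y ∈ g x × z ≡ h x y
  ∈-concatMap₂⁻ {x ∷ xs} z∈ with ∈-++⁻ (map (h x) (g x)) z∈
  ... | inj₁ z∈hx with y , y∈ , z≡ ← ∈-map⁻ (h x) z∈hx = x , y , here refl , y∈ , z≡
  ... | inj₂ z∈rest with x′ , y , x′∈ , y∈ , z≡ ← ∈-concatMap₂⁻ z∈rest =
    x′ , y , there x′∈ , y∈ , z≡

  concatMap₂-unique : (∀ {x x′ y y′} → h x y ≡ h x′ y′ → x ≡ x′ × y ≡ y′) →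
    ∀ {xs} → Unique xs → (∀ x → Unique (g x)) → Unique (concatMap₂ h g xs)
  concatMap₂-unique h-injective [] g! = []
  concatMap₂-unique h-injective {x ∷ xs} (x∉xs ∷ xs!) g! =
    Unique.++⁺ (Unique.map⁺ (proj₂ ∘ h-injective) (g! x)) (concatMap₂-unique h-injective xs! g!)
      λ (z∈hx , z∈rest) →
        let y , _ , z≡hxy = ∈-map⁻ (h x) z∈hx
            x′ , y′ , x′∈ , _ , z≡hx′y′ = ∈-concatMap₂⁻ z∈rest
        in All.lookup x∉xs x′∈ (proj₁ (h-injective (trans (sym z≡hxy) z≡hx′y′)))

  length-concatMap₂ : ∀ xs → length (concatMap₂ h g xs) ≡ sum (map (length ∘ g) xs)
  length-concatMap₂ [] = refl
  length-concatMap₂ (x ∷ xs) = trans (length-++ (map (h x) (g x)))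
    (cong₂ _+_ (length-map (h x) (g x)) (length-concatMap₂ xs))

-- Opaque, so that the family g can be read off xs ⊗ g by unification.
infixr 5 _⊗_
opaque
  _⊗_ : List A → (A → List B) → List (A × B)
  xs ⊗ g = concatMap₂ _,_ g xs

module _ {g : A → List B} where
  opaque
    unfolding _⊗_

    ∈-⊗⁺ : ∀ {xs x y} → x ∈ xs → y ∈ g x → (x , y) ∈ xs ⊗ g
    ∈-⊗⁺ = ∈-concatMap₂⁺ _,_ g

    ∈-⊗⁻ : ∀ {xs x y} → (x , y) ∈ xs ⊗ g → x ∈ xs × y ∈ g x
    ∈-⊗⁻ xy∈ with _ , _ , x∈ , y∈ , refl ← ∈-concatMap₂⁻ _,_ g xy∈ = x∈ , y∈

    ⊗-unique : ∀ {xs} → Unique xs → (∀ x → Unique (g x)) → Unique (xs ⊗ g)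
    ⊗-unique = concatMap₂-unique _,_ g (λ eq → ,-injectiveˡ eq , ,-injectiveʳ eq)

    length-⊗ : ∀ {xs} (f : A → ℕ) → (∀ {x} → x ∈ xs → length (g x) ≡ f x) →
      length (xs ⊗ g) ≡ sum (map f xs)
    length-⊗ {xs} f length-g = trans (length-concatMap₂ _,_ g xs) (sum-map-cong xs length-g)

length-⊗-const : ∀ {g : A → List B} {xs} c → (∀ {x} → x ∈ xs → length (g x) ≡ c) →
  length (xs ⊗ g) ≡ length xs * c
length-⊗-const {xs = xs} c length-g = trans (length-⊗ (λ _ → c) length-g) (sum-map-const c xs)

Increasing : List ℕ → Set
Increasing = AllPairs _<_

Increasing⇒Unique : ∀ {xs} → Increasing xs → Unique xs
Increasing⇒Unique = AllPairs.map <⇒≢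

upTo-increasing : ∀ n → Increasing (upTo n)
upTo-increasing n = AllPairsₚ.applyUpTo⁺₁ (λ x → x) n (λ i<j _ → i<j)

∷ʳ-increasing : ∀ {xs m} → Increasing xs → All (_< m) xs → Increasing (xs ++ [ m ])
∷ʳ-increasing xs↑ xs<m = AllPairsₚ.++⁺ xs↑ ([] ∷ []) (All.map (_∷ []) xs<m)

⊆-increasing : ∀ {xs ys} → xs ⊆ ys → Increasing ys → Increasing xs
⊆-increasing [] [] = []
⊆-increasing (y ∷ʳ xs⊆ys) (_ ∷ ys↑) = ⊆-increasing xs⊆ys ys↑
⊆-increasing (refl ∷ xs⊆ys) (y<ys ∷ ys↑) =
  All.tabulate (All.lookup y<ys ∘ Any-resp-⊆ xs⊆ys) ∷ ⊆-increasing xs⊆ys ys↑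

Increasing-≡ : ∀ {xs ys} → Increasing xs → Increasing ys →
  (∀ {x} → x ∈ xs → x ∈ ys) → (∀ {x} → x ∈ ys → x ∈ xs) → xs ≡ ys
Increasing-≡ xs↑ ys↑ xs⊆ys ys⊆xs = Pointwise-≡⇒≡ (↗↭↗⇒≋ ≤-totalOrder (sorted xs↑) (sorted ys↑)
  (↭⇒↭ₛ′ isEquivalence
    (unique∧same-elements⇒↭ (Increasing⇒Unique xs↑) (Increasing⇒Unique ys↑) xs⊆ys ys⊆xs)))
  where
  sorted : ∀ {zs} → Increasing zs → Sorted zs
  sorted = AllPairs⇒Sorted ≤-totalOrder ∘ AllPairs.map <⇒≤

nth : List ℕ → ℕ → ℕ
nth [] _ = 0
nth (x ∷ xs) zero = x
nth (x ∷ xs) (suc i) = nth xs i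

rank : List ℕ → ℕ → ℕ
rank V y = length (filter (_<? y) V)

nth-∈ : ∀ V {i} → i < length V → nth V i ∈ V
nth-∈ (x ∷ V) {zero} _ = here refl
nth-∈ (x ∷ V) {suc i} (s≤s i<) = there (nth-∈ V i<)

nth-++-length : ∀ xs {y ys} → nth (xs ++ y ∷ ys) (length xs) ≡ y
nth-++-length [] = refl
nth-++-length (x ∷ xs) = nth-++-length xs

nth-monotone : ∀ {V} → Increasing V → ∀ {i j} → i < j → j < length V → nth V i < nth V j
nth-monotone {v ∷ V} (v<V ∷ _) {zero} {suc j} _ (s≤s j<) = All.lookup v<V (nth-∈ V j<)
nth-monotone {v ∷ V} (_ ∷ V↑) {suc i} {suc j} (s≤s i<j) (s≤s j<) = nth-monotone V↑ i<j j<

rank-< : ∀ {V y} → y ∈ V → rank V y < length V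
rank-< {V} y∈V = filter-notAll (_<? _) V (Any.map (λ { refl → <-irrefl refl }) y∈V)

rank-head : ∀ {v V} → All (v <_) V → rank (v ∷ V) v ≡ 0
rank-head {v} v<V = cong length (trans (filter-reject (_<? v) (<-irrefl refl))
  (filter-none (_<? v) (All.map <⇒≯ v<V)))

rank-∷ : ∀ {v V y} → v < y → rank (v ∷ V) y ≡ suc (rank V y)
rank-∷ v<y = cong length (filter-accept (_<? _) v<y)

rank-nth : ∀ {V} → Increasing V → ∀ {i} → i < length V → rank V (nth V i) ≡ i
rank-nth {v ∷ V} (v<V ∷ _) {zero} _ = rank-head v<V
rank-nth {v ∷ V} (v<V ∷ V↑) {suc i} (s≤s i<) =
  trans (rank-∷ (All.lookup v<V (nth-∈ V i<))) (cong suc (rank-nth V↑ i<))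

nth-rank : ∀ {V} → Increasing V → ∀ {y} → y ∈ V → nth V (rank V y) ≡ y
nth-rank (v<V ∷ _) (here refl) rewrite rank-head v<V = refl
nth-rank {v ∷ V} (v<V ∷ V↑) (there y∈V) rewrite rank-∷ {v} {V} (All.lookup v<V y∈V) = nth-rank V↑ y∈V

combinations : List A → ℕ → List (List A)
combinations xs zero = [ [] ]
combinations [] (suc r) = []
combinations (x ∷ xs) (suc r) = map (x ∷_) (combinations xs r) ++ combinations xs (suc r)

length-combinations : ∀ (xs : List A) r → length (combinations xs r) ≡ length xs C r
length-combinations xs zero = refl
length-combinations [] (suc r) = refl
length-combinations (x ∷ xs) (suc r) = begin
  length (map (x ∷_) (combinations xs r) ++ combinations xs (suc r))
    ≡⟨ length-++ (map (x ∷_) (combinations xs r)) ⟩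
  length (map (x ∷_) (combinations xs r)) + length (combinations xs (suc r))
    ≡⟨ cong₂ _+_ (trans (length-map (x ∷_) (combinations xs r)) (length-combinations xs r))
                 (length-combinations xs (suc r)) ⟩
  length xs C r + length xs C suc r
    ≡⟨ nCk+nC[k+1]≡[n+1]C[k+1] (length xs) r ⟩
  suc (length xs) C suc r ∎
  where open ≡-Reasoning

∈-combinations⁻ : ∀ (xs : List A) r {W} → W ∈ combinations xs r → W ⊆ xs × length W ≡ r
∈-combinations⁻ [] zero (here refl) = [] , refl
∈-combinations⁻ (x ∷ xs) zero (here refl) = x ∷ʳ proj₁ (∈-combinations⁻ xs zero (here refl)) , refl
∈-combinations⁻ (x ∷ xs) (suc r) W∈ with ∈-++⁻ (map (x ∷_) (combinations xs r)) W∈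
... | inj₁ W∈with-x with W′ , W′∈ , refl ← ∈-map⁻ (x ∷_) W∈with-x
  = let W′⊆xs , |W′| = ∈-combinations⁻ xs r W′∈ in refl ∷ W′⊆xs , cong suc |W′|
... | inj₂ W∈without-x = let W⊆xs , |W| = ∈-combinations⁻ xs (suc r) W∈without-x in x ∷ʳ W⊆xs , |W|

∈-combinations⁺ : ∀ {W xs : List A} → W ⊆ xs → W ∈ combinations xs (length W)
∈-combinations⁺ [] = here refl
∈-combinations⁺ {W = []} (x ∷ʳ _) = here refl
∈-combinations⁺ {W = w ∷ W} (x ∷ʳ W⊆xs) =
  ∈-++⁺ʳ (map (x ∷_) (combinations _ (length W))) (∈-combinations⁺ W⊆xs)
∈-combinations⁺ (refl ∷ W⊆xs) = ∈-++⁺ˡ (∈-map⁺ (_ ∷_) (∈-combinations⁺ W⊆xs))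

combinations-unique : ∀ {xs : List A} r → Unique xs → Unique (combinations xs r)
combinations-unique zero _ = [] ∷ []
combinations-unique {xs = []} (suc r) _ = []
combinations-unique {xs = x ∷ xs} (suc r) (x∉xs ∷ xs!) =
  Unique.++⁺ (Unique.map⁺ ∷-injectiveʳ (combinations-unique r xs!)) (combinations-unique (suc r) xs!)
    λ (W∈with-x , W∈without-x) →
      let _ , _ , W≡x∷W′ = ∈-map⁻ (x ∷_) W∈with-x
          W⊆xs , _ = ∈-combinations⁻ xs (suc r) W∈without-x
      in All.lookup x∉xs (Any-resp-⊆ W⊆xs (subst (x ∈_) (sym W≡x∷W′) (here refl))) refl

-- The pattern 010

Occurs010 : List ℕ → Set
Occurs010 s = ∃₂ λ a b → a < b × (a ∷ b ∷ a ∷ []) ⊆ s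

∈-pairsFrom⁻ : ∀ {a s x y z} → (x , y , z) ∈ pairsFrom a s → x ≡ a × (y ∷ z ∷ []) ⊆ s
∈-pairsFrom⁻ {a} {b ∷ s} t∈ with ∈-++⁻ (map (λ c → (a , b , c)) s) t∈
... | inj₁ t∈b with c , c∈s , refl ← ∈-map⁻ (λ c → (a , b , c)) t∈b = refl , refl ∷ from∈ c∈s
... | inj₂ t∈rest with x≡a , yz⊆s ← ∈-pairsFrom⁻ t∈rest = x≡a , b ∷ʳ yz⊆s

∈-pairsFrom⁺ : ∀ {a s y z} → (y ∷ z ∷ []) ⊆ s → (a , y , z) ∈ pairsFrom a s
∈-pairsFrom⁺ {a} (refl ∷ z⊆s) = ∈-++⁺ˡ (∈-map⁺ (λ c → (a , _ , c)) (Any-resp-⊆ z⊆s (here refl)))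
∈-pairsFrom⁺ {a} {b ∷ s} (b ∷ʳ yz⊆s) = ∈-++⁺ʳ (map (λ c → (a , b , c)) s) (∈-pairsFrom⁺ yz⊆s)

∈-subs3⁻ : ∀ {s x y z} → (x , y , z) ∈ subs3 s → (x ∷ y ∷ z ∷ []) ⊆ s
∈-subs3⁻ {w ∷ s} t∈ with ∈-++⁻ (pairsFrom w s) t∈
... | inj₁ t∈w with refl , yz⊆s ← ∈-pairsFrom⁻ {w} {s} t∈w = refl ∷ yz⊆s
... | inj₂ t∈rest = w ∷ʳ ∈-subs3⁻ t∈rest

∈-subs3⁺ : ∀ {s x y z} → (x ∷ y ∷ z ∷ []) ⊆ s → (x , y , z) ∈ subs3 s
∈-subs3⁺ (refl ∷ yz⊆s) = ∈-++⁺ˡ (∈-pairsFrom⁺ yz⊆s)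
∈-subs3⁺ {w ∷ s} (w ∷ʳ xyz⊆s) = ∈-++⁺ʳ (pairsFrom w s) (∈-subs3⁺ xyz⊆s)

contains⇒occurs010 : ∀ {s} → Contains010 s → Occurs010 s
contains⇒occurs010 c with (a , b , _) , t∈ , (refl , a<b) ← find c = a , b , a<b , ∈-subs3⁻ t∈

occurs⇒contains010 : ∀ {s} → Occurs010 s → Contains010 s
occurs⇒contains010 (a , b , a<b , aba⊆s) = lose (∈-subs3⁺ aba⊆s) (refl , a<b)

⊆-++⁻ : ∀ {ws : List A} xs {ys} → ws ⊆ xs ++ ys →
  ∃₂ λ us vs → ws ≡ us ++ vs × us ⊆ xs × vs ⊆ ys
⊆-++⁻ [] ws⊆ys = [] , _ , refl , [] , ws⊆ys
⊆-++⁻ (x ∷ xs) (x ∷ʳ ws⊆) with us , vs , refl , us⊆xs , vs⊆ys ← ⊆-++⁻ xs ws⊆ =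
  us , vs , refl , x ∷ʳ us⊆xs , vs⊆ys
⊆-++⁻ (x ∷ xs) (refl ∷ ws⊆) with us , vs , refl , us⊆xs , vs⊆ys ← ⊆-++⁻ xs ws⊆ =
  x ∷ us , vs , refl , refl ∷ us⊆xs , vs⊆ys

occurs010-++⁻ : ∀ xs {ys} → Occurs010 (xs ++ ys) →
  Occurs010 xs ⊎ Occurs010 ys ⊎ ∃ λ a → a ∈ xs × a ∈ ys
occurs010-++⁻ xs {ys} (a , b , a<b , aba⊆) =
  let us , vs , eq , us⊆xs , vs⊆ys = ⊆-++⁻ xs aba⊆ in split us eq us⊆xs vs⊆ys
  where
  split : ∀ us {vs} → a ∷ b ∷ a ∷ [] ≡ us ++ vs → us ⊆ xs → vs ⊆ ys →
    Occurs010 xs ⊎ Occurs010 ys ⊎ ∃ λ a → a ∈ xs × a ∈ ys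
  split [] refl _ vs⊆ys = inj₂ (inj₁ (a , b , a<b , vs⊆ys))
  split (_ ∷ []) refl us⊆xs vs⊆ys =
    inj₂ (inj₂ (a , Any-resp-⊆ us⊆xs (here refl) , Any-resp-⊆ vs⊆ys (there (here refl))))
  split (_ ∷ _ ∷ []) refl us⊆xs vs⊆ys =
    inj₂ (inj₂ (a , Any-resp-⊆ us⊆xs (here refl) , Any-resp-⊆ vs⊆ys (here refl)))
  split (_ ∷ _ ∷ _ ∷ []) refl us⊆xs _ = inj₁ (a , b , a<b , us⊆xs)

occurs010-++⁺ˡ : ∀ {xs} ys → Occurs010 xs → Occurs010 (xs ++ ys)
occurs010-++⁺ˡ ys (a , b , a<b , aba⊆) = a , b , a<b , ++⁺ʳ ys aba⊆

occurs010-++⁺ʳ : ∀ xs {ys} → Occurs010 ys → Occurs010 (xs ++ ys)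
occurs010-++⁺ʳ xs (a , b , a<b , aba⊆) = a , b , a<b , ++⁺ˡ xs aba⊆

occurs010-around : ∀ {xs ys a b} → a ∈ xs → a ∈ ys → a < b → Occurs010 (xs ++ b ∷ ys)
occurs010-around a∈xs a∈ys a<b = _ , _ , a<b , ++⁺ (from∈ a∈xs) (refl ∷ from∈ a∈ys)

StrictlyMonotoneOn : List ℕ → (ℕ → ℕ) → Set
StrictlyMonotoneOn s f = ∀ {x y} → x ∈ s → y ∈ s → x < y → f x < f y

occurs010-map : ∀ {s f} → StrictlyMonotoneOn s f → Occurs010 s → Occurs010 (map f s)
occurs010-map {f = f} f↑ (a , b , a<b , aba⊆s) =
  f a , f b , f↑ (Any-resp-⊆ aba⊆s (here refl)) (Any-resp-⊆ aba⊆s (there (here refl))) a<b ,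
  Sublist.map⁺ f aba⊆s

avoids010-map : ∀ {s f g} → StrictlyMonotoneOn (map f s) g → map g (map f s) ≡ s →
  Avoids010 s → Avoids010 (map f s)
avoids010-map g↑ g∘f≡id s-avoids fs-contains = s-avoids (occurs⇒contains010
  (subst Occurs010 g∘f≡id (occurs010-map g↑ (contains⇒occurs010 fs-contains))))

avoids010-++⁺ : ∀ xs {ys} → Avoids010 xs → Avoids010 ys → Disjoint xs ys → Avoids010 (xs ++ ys)
avoids010-++⁺ xs xs-avoids ys-avoids xs#ys c with occurs010-++⁻ xs (contains⇒occurs010 c)
... | inj₁ in-xs = xs-avoids (occurs⇒contains010 in-xs)
... | inj₂ (inj₁ in-ys) = ys-avoids (occurs⇒contains010 in-ys)
... | inj₂ (inj₂ (_ , a∈xs , a∈ys)) = xs#ys (a∈xs , a∈ys)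

avoids010-++⁻ˡ : ∀ xs ys → Avoids010 (xs ++ ys) → Avoids010 xs
avoids010-++⁻ˡ xs ys xys-avoids =
  xys-avoids ∘ occurs⇒contains010 ∘ occurs010-++⁺ˡ ys ∘ contains⇒occurs010 {xs}

avoids010-++⁻ʳ : ∀ xs ys → Avoids010 (xs ++ ys) → Avoids010 ys
avoids010-++⁻ʳ xs ys xys-avoids =
  xys-avoids ∘ occurs⇒contains010 ∘ occurs010-++⁺ʳ xs ∘ contains⇒occurs010 {ys}

avoids010-disjoint : ∀ {xs b ys} → All (_< b) xs → Avoids010 (xs ++ b ∷ ys) → Disjoint xs (b ∷ ys)
avoids010-disjoint xs<b _ (b∈xs , here refl) = <-irrefl refl (All.lookup xs<b b∈xs)
avoids010-disjoint xs<b avoids (a∈xs , there a∈ys) =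
  avoids (occurs⇒contains010 (occurs010-around a∈xs a∈ys (All.lookup xs<b a∈xs)))

distinct-≡-length : ∀ {s u} → Unique u → (∀ {x} → x ∈ s → x ∈ u) → (∀ {x} → x ∈ u → x ∈ s) →
  distinct s ≡ length u
distinct-≡-length {s} u! s⊆u u⊆s = ↭-length (unique∧same-elements⇒↭ (deduplicate-! s) u!
  (s⊆u ∘ ∈-deduplicate⁻ _≟_ s) (∈-deduplicate⁺ _≟_ ∘ u⊆s))

distinct-++ : ∀ xs ys → Disjoint xs ys → distinct (xs ++ ys) ≡ distinct xs + distinct ys
distinct-++ xs ys xs#ys = trans
  (distinct-≡-length (Unique.++⁺ (deduplicate-! xs) (deduplicate-! ys)
      (λ (x∈xs , x∈ys) → xs#ys (∈-deduplicate⁻ _≟_ xs x∈xs , ∈-deduplicate⁻ _≟_ ys x∈ys)))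
    ([ ∈-++⁺ˡ ∘ ∈-deduplicate⁺ _≟_ , ∈-++⁺ʳ _ ∘ ∈-deduplicate⁺ _≟_ ]′ ∘ ∈-++⁻ xs)
    ([ ∈-++⁺ˡ ∘ ∈-deduplicate⁻ _≟_ xs , ∈-++⁺ʳ xs ∘ ∈-deduplicate⁻ _≟_ ys ]′
      ∘ ∈-++⁻ (deduplicate _≟_ xs)))
  (length-++ (deduplicate _≟_ xs))

unusedBelow : ℕ → List ℕ → List ℕ
unusedBelow m α = filter (_∉? α) (upTo m)

unusedBelow-increasing : ∀ m α → Increasing (unusedBelow m α)
unusedBelow-increasing m α = AllPairsₚ.filter⁺ (_∉? α) (upTo-increasing m)

∈-unusedBelow⁻ : ∀ {m α x} → x ∈ unusedBelow m α → x < m × x ∉ α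
∈-unusedBelow⁻ {m} {α} x∈ with x∈upTo , x∉α ← ∈-filter⁻ (_∉? α) {xs = upTo m} x∈ =
  ∈-upTo⁻ x∈upTo , x∉α

length-unusedBelow : ∀ {m α} → All (_< m) α → length (unusedBelow m α) ≡ m ∸ distinct α
length-unusedBelow {m} {α} α<m = begin
  length (unusedBelow m α)
    ≡⟨ m+n∸m≡n (length used) _ ⟨
  length used + length (unusedBelow m α) ∸ length used
    ≡⟨ cong₂ _∸_ (length-filter+length-filter-∁ (_∈? α) (upTo m)) |used| ⟩
  length (upTo m) ∸ distinct α
    ≡⟨ cong (_∸ distinct α) (length-upTo m) ⟩
  m ∸ distinct α ∎
  where
  open ≡-Reasoning
  used : List ℕ
  used = filter (_∈? α) (upTo m)
  |used| : length used ≡ distinct α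
  |used| = sym (distinct-≡-length (Unique.filter⁺ (_∈? α) (Unique.upTo⁺ m))
    (λ x∈α → ∈-filter⁺ (_∈? α) (∈-upTo⁺ (All.lookup α<m x∈α)) x∈α)
    (proj₂ ∘ ∈-filter⁻ (_∈? α) {xs = upTo m}))

foldr-⊔-∈ : ∀ x s → foldr _⊔_ x s ∈ x ∷ s
foldr-⊔-∈ x [] = here refl
foldr-⊔-∈ x (y ∷ s) with ⊔-sel y (foldr _⊔_ x s) | foldr-⊔-∈ x s
... | inj₁ ≡y | _ = there (here ≡y)
... | inj₂ ≡rest | here ≡x = here (trans ≡rest ≡x)
... | inj₂ ≡rest | there ∈s = there (there (subst (_∈ s) (sym ≡rest) ∈s))

foldr-⊔-upper : ∀ x s → All (_≤ foldr _⊔_ x s) (x ∷ s)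
foldr-⊔-upper x [] = ≤-refl ∷ []
foldr-⊔-upper x (y ∷ s) with x≤ ∷ s≤ ← foldr-⊔-upper x s =
  m≤n⇒m≤o⊔n y x≤ ∷ m≤m⊔n y _ ∷ All.map (m≤n⇒m≤o⊔n y) s≤

maxSeq-≡⁺ : ∀ {s m} → m ∈ s → All (_≤ m) s → maxSeq s ≡ ℤ.+ m
maxSeq-≡⁺ {x ∷ s} m∈s s≤m = cong ℤ.+_ (≤-antisym
  (All.lookup s≤m (foldr-⊔-∈ x s)) (All.lookup (foldr-⊔-upper x s) m∈s))

maxSeq-≡⁻ : ∀ {s m} → maxSeq s ≡ ℤ.+ m → m ∈ s × All (_≤ m) s
maxSeq-≡⁻ {x ∷ s} refl = foldr-⊔-∈ x s , foldr-⊔-upper x s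

maxSeq-<⁻ : ∀ {s j m} → maxSeq s ≡ ℤ.+ j → j < m → All (_< m) s
maxSeq-<⁻ max≡j j<m = All.map (λ x≤j → ≤-<-trans x≤j j<m) (proj₂ (maxSeq-≡⁻ max≡j))

-- The entry in position i (counted from 0) is at most k + i, so InversionFrom 0 is the condition σᵢ < i.
InversionFrom : ℕ → List ℕ → Set
InversionFrom k [] = ⊤
InversionFrom k (x ∷ s) = x ≤ k × InversionFrom (suc k) s

InversionFrom-++⁻ : ∀ k xs {ys} → InversionFrom k (xs ++ ys) →
  InversionFrom k xs × InversionFrom (k + length xs) ys
InversionFrom-++⁻ k [] inv rewrite +-identityʳ k = tt , inv
InversionFrom-++⁻ k (x ∷ xs) (x≤k , inv) rewrite +-suc k (length xs) =
  let xs-inv , ys-inv = InversionFrom-++⁻ (suc k) xs inv in (x≤k , xs-inv) , ys-inv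

InversionFrom-++⁺ : ∀ k xs {ys} → InversionFrom k xs → InversionFrom (k + length xs) ys →
  InversionFrom k (xs ++ ys)
InversionFrom-++⁺ k [] _ ys-inv rewrite +-identityʳ k = ys-inv
InversionFrom-++⁺ k (x ∷ xs) (x≤k , xs-inv) ys-inv rewrite +-suc k (length xs) =
  x≤k , InversionFrom-++⁺ (suc k) xs xs-inv ys-inv

InversionFrom-bounded : ∀ {k s} → All (_≤ k) s → InversionFrom k s
InversionFrom-bounded [] = tt
InversionFrom-bounded (x≤k ∷ s≤k) = x≤k , InversionFrom-bounded (All.map m≤n⇒m≤1+n s≤k)

∈-invSeqs⁻ : ∀ n {s} → s ∈ invSeqs n → length s ≡ n × InversionFrom 0 s
∈-invSeqs⁻ zero (here refl) = refl , tt
∈-invSeqs⁻ (suc n) s∈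
  with s′ , v , s′∈ , v∈ , refl ← ∈-concatMap₂⁻ (λ s v → s ++ [ v ]) (λ _ → upTo (suc n)) s∈ =
  let |s′| , s′-inv = ∈-invSeqs⁻ n s′∈ in
  trans (length-++ s′) (trans (cong (_+ 1) |s′|) (+-comm n 1)) ,
  InversionFrom-++⁺ 0 s′ s′-inv (subst (v ≤_) (sym |s′|) (≤-pred (∈-upTo⁻ v∈)) , tt)

∈-invSeqs⁺ : ∀ n {s} → length s ≡ n → InversionFrom 0 s → s ∈ invSeqs n
∈-invSeqs⁺ zero {[]} _ _ = here refl
∈-invSeqs⁺ (suc n) {s} |s| s-inv with initLast s
... | s′ ∷ʳ′ v =
  let |s′| = suc-injective (trans (sym (trans (length-++ s′) (+-comm (length s′) 1))) |s|)
      s′-inv , v≤ , _ = InversionFrom-++⁻ 0 s′ s-inv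
  in ∈-concatMap₂⁺ (λ s v → s ++ [ v ]) (λ _ → upTo (suc n)) (∈-invSeqs⁺ n |s′| s′-inv)
       (∈-upTo⁺ (s≤s (subst (v ≤_) |s′| v≤)))

invSeqs-unique : ∀ n → Unique (invSeqs n)
invSeqs-unique zero = [] ∷ []
invSeqs-unique (suc n) = concatMap₂-unique (λ s v → s ++ [ v ]) (λ _ → upTo (suc n))
  (λ {s} {s′} eq → ∷ʳ-injective s s′ eq) (invSeqs-unique n) (λ _ → Unique.upTo⁺ (suc n))

∈-words⁻ : ∀ k n {w} → w ∈ words k n → length w ≡ n × All (_< k) w
∈-words⁻ k zero (here refl) = refl , []
∈-words⁻ k (suc n) w∈
  with w′ , v , w′∈ , v∈ , refl ← ∈-concatMap₂⁻ (λ w v → v ∷ w) (λ _ → upTo k) {words k n} w∈ =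
  let |w′| , w′<k = ∈-words⁻ k n w′∈ in cong suc |w′| , ∈-upTo⁻ v∈ ∷ w′<k

∈-words⁺ : ∀ k n {w} → length w ≡ n → All (_< k) w → w ∈ words k n
∈-words⁺ k zero {[]} _ _ = here refl
∈-words⁺ k (suc n) {v ∷ w} |w| (v<k ∷ w<k) =
  ∈-concatMap₂⁺ (λ w v → v ∷ w) (λ _ → upTo k) (∈-words⁺ k n (suc-injective |w|) w<k) (∈-upTo⁺ v<k)

words-unique : ∀ k n → Unique (words k n)
words-unique k zero = [] ∷ []
words-unique k (suc n) = concatMap₂-unique (λ w v → v ∷ w) (λ _ → upTo k)
  (λ { refl → refl , refl }) (words-unique k n) (λ _ → Unique.upTo⁺ k)

-- Order-preserving relabelling

module Relabel {V : List ℕ} (V↑ : Increasing V) where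

  rank-monotone : ∀ {x y} → x ∈ V → y ∈ V → x < y → rank V x < rank V y
  rank-monotone {x} {y} x∈V y∈V x<y with <-cmp (rank V x) (rank V y)
  ... | tri< rx<ry _ _ = rx<ry
  ... | tri≈ _ rx≡ry _ = contradiction
    (trans (sym (nth-rank V↑ x∈V)) (trans (cong (nth V) rx≡ry) (nth-rank V↑ y∈V))) (<⇒≢ x<y)
  ... | tri> _ _ ry<rx = contradiction
    (subst₂ _<_ (nth-rank V↑ y∈V) (nth-rank V↑ x∈V) (nth-monotone V↑ ry<rx (rank-< x∈V))) (<-asym x<y)

  rank-strictlyMonotone : ∀ {τ} → All (_∈ V) τ → StrictlyMonotoneOn τ (rank V)
  rank-strictlyMonotone τ⊆V x∈τ y∈τ = rank-monotone (All.lookup τ⊆V x∈τ) (All.lookup τ⊆V y∈τ)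

  nth-strictlyMonotone : ∀ {ω} → All (_< length V) ω → StrictlyMonotoneOn ω (nth V)
  nth-strictlyMonotone ω<|V| _ j∈ω i<j = nth-monotone V↑ i<j (All.lookup ω<|V| j∈ω)

  map-nth-∈ : ∀ {ω} → All (_< length V) ω → All (_∈ V) (map (nth V) ω)
  map-nth-∈ ω<|V| = All.map⁺ (All.map (nth-∈ V) ω<|V|)

  map-rank-< : ∀ {τ} → All (_∈ V) τ → All (_< length V) (map (rank V) τ)
  map-rank-< τ⊆V = All.map⁺ (All.map rank-< τ⊆V)

  map-rank-nth : ∀ {ω} → All (_< length V) ω → map (rank V) (map (nth V) ω) ≡ ω
  map-rank-nth {ω} ω<|V| = trans (sym (map-∘ ω)) (map-id-local (All.map (rank-nth V↑) ω<|V|))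

  map-nth-rank : ∀ {τ} → All (_∈ V) τ → map (nth V) (map (rank V) τ) ≡ τ
  map-nth-rank {τ} τ⊆V = trans (sym (map-∘ τ)) (map-id-local (All.map (nth-rank V↑) τ⊆V))

  avoids010-map-nth : ∀ {ω} → All (_< length V) ω → Avoids010 ω → Avoids010 (map (nth V) ω)
  avoids010-map-nth ω<|V| = avoids010-map (rank-strictlyMonotone (map-nth-∈ ω<|V|)) (map-rank-nth ω<|V|)

  avoids010-map-rank : ∀ {τ} → All (_∈ V) τ → Avoids010 τ → Avoids010 (map (rank V) τ)
  avoids010-map-rank τ⊆V = avoids010-map (nth-strictlyMonotone (map-rank-< τ⊆V)) (map-nth-rank τ⊆V)

  ∈-map-nth : ∀ {ω x} → Surjective (length V) ω → x ∈ V → x ∈ map (nth V) ω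
  ∈-map-nth {ω} ω-onto x∈V = subst (_∈ map (nth V) ω) (nth-rank V↑ x∈V)
    (∈-map⁺ (nth V) (All.lookup ω-onto (∈-upTo⁺ (rank-< x∈V))))

  surjective-map-rank : ∀ {τ} → (∀ {x} → x ∈ V → x ∈ τ) → Surjective (length V) (map (rank V) τ)
  surjective-map-rank V⊆τ = All.tabulate λ r∈ → let r<|V| = ∈-upTo⁻ r∈ in
    subst (_∈ map (rank V) _) (rank-nth V↑ r<|V|) (∈-map⁺ (rank V) (V⊆τ (nth-∈ V r<|V|)))

valuesBelow : ℕ → List ℕ → List ℕ
valuesBelow m τ = filter (_∈? τ) (upTo m)

valuesBelow-increasing : ∀ m τ → Increasing (valuesBelow m τ)
valuesBelow-increasing m τ = AllPairsₚ.filter⁺ (_∈? τ) (upTo-increasing m)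

∈-valuesBelow⁻ : ∀ {m τ x} → x ∈ valuesBelow m τ → x < m × x ∈ τ
∈-valuesBelow⁻ {m} {τ} x∈ with x∈upTo , x∈τ ← ∈-filter⁻ (_∈? τ) {xs = upTo m} x∈ =
  ∈-upTo⁻ x∈upTo , x∈τ

∈-valuesBelow⁺ : ∀ {m τ x} → x < m → x ∈ τ → x ∈ valuesBelow m τ
∈-valuesBelow⁺ {τ = τ} x<m = ∈-filter⁺ (_∈? τ) (∈-upTo⁺ x<m)

module Peak {m : ℕ} {W : List ℕ} (W↑ : Increasing W) (W<m : All (_< m) W) where

  V : List ℕ
  V = W ++ [ m ]

  V↑ : Increasing V
  V↑ = ∷ʳ-increasing W↑ W<m

  open Relabel V↑ public

  length-V : length V ≡ suc (length W)
  length-V = trans (length-++ W) (+-comm (length W) 1)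

  nth-V-peak : nth V (length W) ≡ m
  nth-V-peak = nth-++-length W

  rank-V-peak : rank V m ≡ length W
  rank-V-peak = trans (cong (rank V) (sym nth-V-peak)) (rank-nth V↑ (≤-reflexive (sym length-V)))

  V≤m : ∀ {x} → x ∈ V → x ≤ m
  V≤m x∈V with ∈-++⁻ W x∈V
  ... | inj₁ x∈W = <⇒≤ (All.lookup W<m x∈W)
  ... | inj₂ (here refl) = ≤-refl

  distinct-≡-length-V : ∀ {τ} → All (_∈ V) τ → (∀ {x} → x ∈ V → x ∈ τ) → distinct τ ≡ length V
  distinct-≡-length-V τ⊆V = distinct-≡-length (Increasing⇒Unique V↑) (All.lookup τ⊆V)

  valuesBelow-≡ : ∀ {τ} → All (_∈ V) τ → (∀ {x} → x ∈ V → x ∈ τ) → valuesBelow m τ ≡ W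
  valuesBelow-≡ {τ} τ⊆V V⊆τ = Increasing-≡ (valuesBelow-increasing m τ) W↑ below⊆W W⊆below
    where
    below⊆W : ∀ {x} → x ∈ valuesBelow m τ → x ∈ W
    below⊆W x∈ with x<m , x∈τ ← ∈-valuesBelow⁻ {m} x∈ with ∈-++⁻ W (All.lookup τ⊆V x∈τ)
    ... | inj₁ x∈W = x∈W
    ... | inj₂ (here refl) = contradiction x<m (<-irrefl refl)
    W⊆below : ∀ {x} → x ∈ W → x ∈ valuesBelow m τ
    W⊆below x∈W = ∈-valuesBelow⁺ (All.lookup W<m x∈W) (V⊆τ (∈-++⁺ˡ x∈W))

-- Splitting at the first maximum

break-++-∷ : ∀ {P : A → Set} (P? : Decidable P) {α x β} →
  All (¬_ ∘ P) α → P x → break P? (α ++ x ∷ β) ≡ (α , x ∷ β)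
break-++-∷ P? {[]} {x} [] Px with P? x
... | yes _ = refl
... | no ¬Px = contradiction Px ¬Px
break-++-∷ P? {a ∷ α} {x} {β} (¬Pa ∷ ¬Pα) Px with P? a
... | yes Pa = contradiction Pa ¬Pa
... | no _ rewrite break-++-∷ P? {α} {x} {β} ¬Pα Px = refl

first-occurrence : ∀ {m σ} → m ∈ σ → ∃₂ λ α β → σ ≡ α ++ m ∷ β × All (_≢ m) α
first-occurrence {m} {x ∷ σ} m∈σ with x ≟ m | m∈σ
... | yes refl | _ = [] , σ , refl , []
... | no x≢m | here refl = contradiction refl x≢m
... | no x≢m | there m∈σ′ with α , β , refl , α≢m ← first-occurrence m∈σ′ =
  x ∷ α , β , refl , x≢m ∷ α≢m

-- aCount n m d ≡ length (𝔄 n m d) and bCount n k ≡ length (𝔅 n k) hold definitionally.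
𝔄 : ℕ → ℕ → ℕ → List (List ℕ)
𝔄 n m d = filter (λ σ → avoids010? σ ×-dec (maxSeq σ ℤ.≟ ℤ.+ m) ×-dec (distinct σ ≟ d)) (invSeqs n)

𝔅 : ℕ → ℕ → List (List ℕ)
𝔅 n k = filter (λ ω → avoids010? ω ×-dec surjective? k ω ×-dec headIs? (k ∸ 1) ω) (words k n)

∈-𝔄⁻ : ∀ {n m d σ} → σ ∈ 𝔄 n m d →
  σ ∈ invSeqs n × Avoids010 σ × maxSeq σ ≡ ℤ.+ m × distinct σ ≡ d
∈-𝔄⁻ {n} σ∈ = ∈-filter⁻ _ {xs = invSeqs n} σ∈

∈-𝔄⁺ : ∀ {n m d σ} → σ ∈ invSeqs n → Avoids010 σ → maxSeq σ ≡ ℤ.+ m → distinct σ ≡ d →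
  σ ∈ 𝔄 n m d
∈-𝔄⁺ σ-inv σ-avoids σ-max σ-distinct = ∈-filter⁺ _ σ-inv (σ-avoids , σ-max , σ-distinct)

∈-𝔅⁻ : ∀ {n k ω} → ω ∈ 𝔅 n k → ω ∈ words k n × Avoids010 ω × Surjective k ω × HeadIs (k ∸ 1) ω
∈-𝔅⁻ {n} {k} ω∈ = ∈-filter⁻ _ {xs = words k n} ω∈

∈-𝔅⁺ : ∀ {n k ω} → ω ∈ words k n → Avoids010 ω → Surjective k ω → HeadIs (k ∸ 1) ω →
  ω ∈ 𝔅 n k
∈-𝔅⁺ ω-word ω-avoids ω-onto ω-head = ∈-filter⁺ _ ω-word (ω-avoids , ω-onto , ω-head)

-- (i , p , j , α , W , ω): σ = α ++ τ where τ starts at the first m, in position p; α has i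
-- distinct values and maximum j, W lists the values of τ below m, and ω is τ relabelled onto 0 … d − i − 1.
Decomposition : Set
Decomposition = ℕ × ℕ × ℕ × List ℕ × List ℕ × List ℕ

decompositions : ℕ → ℕ → ℕ → List Decomposition
decompositions n m d =
  range 0 (d ∸ 1) ⊗ λ i →
  range (m + 1) n ⊗ λ p →
  range 0 (m ∸ 1) ⊗ λ j →
  𝔄 (p ∸ 1) j i ⊗ λ α →
  combinations (unusedBelow m α) (d ∸ i ∸ 1) ⊗ λ _ →
  𝔅 (n ∸ p + 1) (d ∸ i)

assemble : ℕ → Decomposition → List ℕ
assemble m (_ , _ , _ , α , W , ω) = α ++ map (nth (W ++ [ m ])) ω

decomposeAt : ℕ → List ℕ × List ℕ → Decomposition
decomposeAt m (α , τ) =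
  distinct α , length α + 1 , ℤ.∣ maxSeq α ∣ , α , valuesBelow m τ , map (rank (valuesBelow m τ ++ [ m ])) τ

decompose : ℕ → List ℕ → Decomposition
decompose m σ = decomposeAt m (break (_≟ m) σ)

module Assembly {n m d i p j : ℕ} {α W ω : List ℕ}
  (i<d : i < d) (m<p : m < p) (p≤n : p ≤ n) (j<m : j < m)
  (α-inv : α ∈ invSeqs (p ∸ 1)) (α-avoids : Avoids010 α)
  (α-max : maxSeq α ≡ ℤ.+ j) (α-distinct : distinct α ≡ i)
  (W⊆unused : W ⊆ unusedBelow m α) (|W| : length W ≡ d ∸ i ∸ 1)
  (ω-word : ω ∈ words (d ∸ i) (n ∸ p + 1)) (ω-avoids : Avoids010 ω)
  (ω-onto : Surjective (d ∸ i) ω) (ω-head : HeadIs (d ∸ i ∸ 1) ω)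
  where

  private
    |α| : length α ≡ p ∸ 1
    |α| = proj₁ (∈-invSeqs⁻ (p ∸ 1) α-inv)

    α<m : All (_< m) α
    α<m = maxSeq-<⁻ α-max j<m

    W-unused : ∀ {x} → x ∈ W → x < m × x ∉ α
    W-unused = ∈-unusedBelow⁻ ∘ Any-resp-⊆ W⊆unused

  open Peak (⊆-increasing W⊆unused (unusedBelow-increasing m α)) (All.tabulate (proj₁ ∘ W-unused))

  private
    |V| : length V ≡ d ∸ i
    |V| = trans length-V (trans (cong suc |W|) (trans (+-comm 1 _) (m∸n+n≡m (m<n⇒0<n∸m i<d))))

    ω<|V| : All (_< length V) ω
    ω<|V| = subst (λ k → All (_< k) ω) (sym |V|) (proj₂ (∈-words⁻ (d ∸ i) (n ∸ p + 1) ω-word))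

    τ : List ℕ
    τ = map (nth V) ω

    τ-head : ∃ λ β → τ ≡ m ∷ β
    τ-head = starts-with-peak ω ω-head
      where
      starts-with-peak : ∀ ω → HeadIs (d ∸ i ∸ 1) ω → ∃ λ β → map (nth V) ω ≡ m ∷ β
      starts-with-peak (_ ∷ ω′) refl =
        map (nth V) ω′ , cong (_∷ map (nth V) ω′) (trans (cong (nth V) (sym |W|)) nth-V-peak)

    τ⊆V : All (_∈ V) τ
    τ⊆V = map-nth-∈ ω<|V|

    V⊆τ : ∀ {x} → x ∈ V → x ∈ τ
    V⊆τ = ∈-map-nth (subst (λ k → Surjective k ω) (sym |V|) ω-onto)

    α#τ : Disjoint α τ
    α#τ (x∈α , x∈τ) with ∈-++⁻ W (All.lookup τ⊆V x∈τ)
    ... | inj₁ x∈W = proj₂ (W-unused x∈W) x∈α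
    ... | inj₂ (here refl) = <-irrefl refl (All.lookup α<m x∈α)

    σ-avoids : Avoids010 (α ++ τ)
    σ-avoids = avoids010-++⁺ α α-avoids (avoids010-map-nth ω<|V| ω-avoids) α#τ

    σ-max : maxSeq (α ++ τ) ≡ ℤ.+ m
    σ-max = maxSeq-≡⁺ (∈-++⁺ʳ α (V⊆τ (∈-++⁺ʳ W (here refl))))
      (All.++⁺ (All.map <⇒≤ α<m) (All.map V≤m τ⊆V))

    σ-distinct : distinct (α ++ τ) ≡ d
    σ-distinct = begin
      distinct (α ++ τ)           ≡⟨ distinct-++ α τ α#τ ⟩
      distinct α + distinct τ     ≡⟨ cong₂ _+_ α-distinct (distinct-≡-length-V τ⊆V V⊆τ) ⟩
      i + length V                ≡⟨ cong (i +_) |V| ⟩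
      i + (d ∸ i)                 ≡⟨ m+[n∸m]≡n (<⇒≤ i<d) ⟩
      d                           ∎
      where open ≡-Reasoning

    1≤p : 1 ≤ p
    1≤p = ≤-trans (s≤s z≤n) m<p

    σ-inv : α ++ τ ∈ invSeqs n
    σ-inv = ∈-invSeqs⁺ n |σ| (InversionFrom-++⁺ 0 α (proj₂ (∈-invSeqs⁻ (p ∸ 1) α-inv))
                                                  (InversionFrom-bounded (All.map τ≤|α| τ⊆V)))
      where
      |ω| : length ω ≡ n ∸ p + 1
      |ω| = proj₁ (∈-words⁻ (d ∸ i) (n ∸ p + 1) ω-word)
      |σ| : length (α ++ τ) ≡ n
      |σ| = trans (length-++ α)
        (trans (cong₂ _+_ |α| (trans (length-map (nth V) ω) |ω|)) ([p∸1]+[n∸p+1]≡n 1≤p p≤n))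
      τ≤|α| : ∀ {x} → x ∈ V → x ≤ length α
      τ≤|α| x∈V = ≤-trans (V≤m x∈V) (subst (m ≤_) (sym |α|) (<⇒≤∸1 m<p))

  assemble-∈𝔄 : α ++ τ ∈ 𝔄 n m d
  assemble-∈𝔄 = ∈-𝔄⁺ {n} σ-inv σ-avoids σ-max σ-distinct

  decompose-assemble : decompose m (α ++ τ) ≡ (i , p , j , α , W , ω)
  decompose-assemble = begin
    decomposeAt m (break (_≟ m) (α ++ τ))
      ≡⟨ cong (decomposeAt m) break-σ ⟩
    decomposeAt m (α , τ)
      ≡⟨ cong (λ W′ → distinct α , length α + 1 , ℤ.∣ maxSeq α ∣ , α , W′ , map (rank (W′ ++ [ m ])) τ)
          (valuesBelow-≡ τ⊆V V⊆τ) ⟩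
    (distinct α , length α + 1 , ℤ.∣ maxSeq α ∣ , α , W , map (rank V) τ)
      ≡⟨ cong₂ (λ (i′ , p′ , j′) ω″ → i′ , p′ , j′ , α , W , ω″) ijp≡ (map-rank-nth ω<|V|) ⟩
    (i , p , j , α , W , ω) ∎
    where
    open ≡-Reasoning
    break-σ : break (_≟ m) (α ++ τ) ≡ (α , τ)
    break-σ with β , τ≡m∷β ← τ-head rewrite τ≡m∷β = break-++-∷ (_≟ m) (All.map <⇒≢ α<m) refl
    ijp≡ : (distinct α , length α + 1 , ℤ.∣ maxSeq α ∣) ≡ (i , p , j)
    ijp≡ = cong₂ _,_ α-distinct (cong₂ _,_ (trans (cong (_+ 1) |α|) (m∸n+n≡m 1≤p)) (cong ℤ.∣_∣ α-max))

module Splitting {n m d : ℕ} {α β : List ℕ} (1≤m : 1 ≤ m) (α≢m : All (_≢ m) α)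
  (σ-inv : α ++ m ∷ β ∈ invSeqs n) (σ-avoids : Avoids010 (α ++ m ∷ β))
  (σ-max : maxSeq (α ++ m ∷ β) ≡ ℤ.+ m) (σ-distinct : distinct (α ++ m ∷ β) ≡ d)
  where

  private
    τ : List ℕ
    τ = m ∷ β

    σ≤m : All (_≤ m) (α ++ τ)
    σ≤m = proj₂ (maxSeq-≡⁻ σ-max)

    α<m : All (_< m) α
    α<m = All.zipWith (λ (x≤m , x≢m) → ≤∧≢⇒< x≤m x≢m) (All.++⁻ˡ α σ≤m , α≢m)

    |σ| : length (α ++ τ) ≡ n
    |σ| = proj₁ (∈-invSeqs⁻ n σ-inv)

    α-inv : InversionFrom 0 α
    α-inv = proj₁ (InversionFrom-++⁻ 0 α (proj₂ (∈-invSeqs⁻ n σ-inv)))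

    m≤|α| : m ≤ length α
    m≤|α| = proj₁ (proj₂ (InversionFrom-++⁻ 0 α (proj₂ (∈-invSeqs⁻ n σ-inv))))

    α#τ : Disjoint α τ
    α#τ = avoids010-disjoint α<m σ-avoids

  open Peak (valuesBelow-increasing m τ) (All.tabulate (proj₁ ∘ ∈-valuesBelow⁻ {m}))

  private
    W : List ℕ
    W = valuesBelow m τ

    τ⊆V : All (_∈ V) τ
    τ⊆V = All.tabulate λ {x} x∈τ →
      [ (λ x<m → ∈-++⁺ˡ (∈-valuesBelow⁺ x<m x∈τ)) , (λ { refl → ∈-++⁺ʳ W (here refl) }) ]′
        (m≤n⇒m<n∨m≡n (All.lookup (All.++⁻ʳ α σ≤m) x∈τ))

    V⊆τ : ∀ {x} → x ∈ V → x ∈ τ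
    V⊆τ x∈V with ∈-++⁻ W x∈V
    ... | inj₁ x∈W = proj₂ (∈-valuesBelow⁻ {m} x∈W)
    ... | inj₂ (here refl) = here refl

    i : ℕ
    i = distinct α

    i+|V|≡d : i + length V ≡ d
    i+|V|≡d = begin
      i + length V             ≡⟨ cong (i +_) (distinct-≡-length-V τ⊆V V⊆τ) ⟨
      distinct α + distinct τ  ≡⟨ distinct-++ α τ α#τ ⟨
      distinct (α ++ τ)        ≡⟨ σ-distinct ⟩
      d                        ∎
      where open ≡-Reasoning

    |V|≡d∸i : length V ≡ d ∸ i
    |V|≡d∸i = trans (sym (m+n∸m≡n i (length V))) (cong (_∸ i) i+|V|≡d)

    |W|≡d∸i∸1 : length W ≡ d ∸ i ∸ 1
    |W|≡d∸i∸1 = cong (_∸ 1) (trans (sym length-V) |V|≡d∸i)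

    i<d : i < d
    i<d = subst (i <_) i+|V|≡d (m<m+n i (subst (0 <_) (sym length-V) (s≤s z≤n)))

    p : ℕ
    p = length α + 1

    j : ℕ
    j = ℤ.∣ maxSeq α ∣

    α-max : maxSeq α ≡ ℤ.+ j
    α-max = nonempty-max α (≤-trans 1≤m m≤|α|)
      where
      nonempty-max : ∀ s → 1 ≤ length s → maxSeq s ≡ ℤ.+ ℤ.∣ maxSeq s ∣
      nonempty-max (_ ∷ _) _ = refl

    j<m : j < m
    j<m = All.lookup α<m (proj₁ (maxSeq-≡⁻ α-max))

    ω : List ℕ
    ω = map (rank V) τ

    |ω| : length ω ≡ n ∸ p + 1
    |ω| = trans (length-map (rank V) τ)
      (trans (sym (m+[1+n]∸[m+1]+1≡1+n (length α) (length β)))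
             (cong (λ k → k ∸ p + 1) (trans (sym (length-++ α)) |σ|)))

  decompose-σ : decompose m (α ++ τ) ≡ (i , p , j , α , W , ω)
  decompose-σ = cong (decomposeAt m) (break-++-∷ (_≟ m) α≢m refl)

  assemble-decompose : assemble m (i , p , j , α , W , ω) ≡ α ++ τ
  assemble-decompose = cong (α ++_) (map-nth-rank τ⊆V)

  α∈𝔄 : α ∈ 𝔄 (p ∸ 1) j i
  α∈𝔄 = ∈-𝔄⁺ {p ∸ 1} (∈-invSeqs⁺ (p ∸ 1) (sym (m+n∸n≡m (length α) 1)) α-inv)
    (avoids010-++⁻ˡ α τ σ-avoids) α-max refl

  W∈combinations : W ∈ combinations (unusedBelow m α) (d ∸ i ∸ 1)
  W∈combinations = subst (λ r → W ∈ combinations (unusedBelow m α) r) |W|≡d∸i∸1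
    (∈-combinations⁺ (Sublist.filter⁺ (_∈? τ) (_∉? α) (λ { refl x∈τ x∈α → α#τ (x∈α , x∈τ) })
                                        (⊆-refl {x = upTo m})))

  ω∈𝔅 : ω ∈ 𝔅 (n ∸ p + 1) (d ∸ i)
  ω∈𝔅 = ∈-𝔅⁺ {n ∸ p + 1}
    (∈-words⁺ (d ∸ i) (n ∸ p + 1) |ω| (subst (λ k → All (_< k) ω) |V|≡d∸i (map-rank-< τ⊆V)))
    (avoids010-map-rank τ⊆V (avoids010-++⁻ʳ α τ σ-avoids))
    (subst (λ k → Surjective k ω) |V|≡d∸i (surjective-map-rank V⊆τ))
    (trans rank-V-peak |W|≡d∸i∸1)

  parts-∈-decompositions : (i , p , j , α , W , ω) ∈ decompositions n m d
  parts-∈-decompositions =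
    ∈-⊗⁺ (∈-range⁺ z≤n (<⇒≤∸1 i<d)) (∈-⊗⁺ p∈ (∈-⊗⁺ (∈-range⁺ z≤n (<⇒≤∸1 j<m))
      (∈-⊗⁺ α∈𝔄 (∈-⊗⁺ W∈combinations ω∈𝔅))))
    where
    p≤n : p ≤ n
    p≤n = subst (p ≤_) (trans (sym (length-++ α)) |σ|) (+-monoʳ-≤ (length α) (s≤s z≤n))
    p∈ : p ∈ range (m + 1) n
    p∈ = ∈-range⁺ (+-monoˡ-≤ 1 m≤|α|) p≤n

∈-decompositions⁻ : ∀ {n m d i p j α W ω} → (i , p , j , α , W , ω) ∈ decompositions n m d →
  i ∈ range 0 (d ∸ 1) × p ∈ range (m + 1) n × j ∈ range 0 (m ∸ 1) × α ∈ 𝔄 (p ∸ 1) j i ×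
  W ∈ combinations (unusedBelow m α) (d ∸ i ∸ 1) × ω ∈ 𝔅 (n ∸ p + 1) (d ∸ i)
∈-decompositions⁻ t∈ =
  let i∈ , t₁∈ = ∈-⊗⁻ t∈
      p∈ , t₂∈ = ∈-⊗⁻ t₁∈
      j∈ , t₃∈ = ∈-⊗⁻ t₂∈
      α∈ , t₄∈ = ∈-⊗⁻ t₃∈
      W∈ , ω∈ = ∈-⊗⁻ t₄∈
  in i∈ , p∈ , j∈ , α∈ , W∈ , ω∈

assemble-∈ : ∀ {n m d t} → 1 ≤ d → 1 ≤ m → t ∈ decompositions n m d →
  assemble m t ∈ 𝔄 n m d × decompose m (assemble m t) ≡ t
assemble-∈ {n} {m} {d} {i , p , j , α , W , ω} 1≤d 1≤m t∈
  with i∈ , p∈ , j∈ , α∈ , W∈ , ω∈ ← ∈-decompositions⁻ t∈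
  with α-inv , α-avoids , α-max , α-distinct ← ∈-𝔄⁻ {p ∸ 1} α∈
  with W⊆unused , |W| ← ∈-combinations⁻ (unusedBelow m α) (d ∸ i ∸ 1) W∈
  with ω-word , ω-avoids , ω-onto , ω-head ← ∈-𝔅⁻ {n ∸ p + 1} ω∈
  = assemble-∈𝔄 , decompose-assemble
  where
  open Assembly (≤∸1⇒< 1≤d (proj₂ (∈-range⁻ {0} {d ∸ 1} i∈)))
    (subst (_≤ p) (+-comm m 1) (proj₁ (∈-range⁻ {m + 1} {n} p∈))) (proj₂ (∈-range⁻ {m + 1} {n} p∈))
    (≤∸1⇒< 1≤m (proj₂ (∈-range⁻ {0} {m ∸ 1} j∈)))
    α-inv α-avoids α-max α-distinct W⊆unused |W| ω-word ω-avoids ω-onto ω-head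

decompose-∈ : ∀ {n m d σ} → 1 ≤ m → σ ∈ 𝔄 n m d →
  decompose m σ ∈ decompositions n m d × assemble m (decompose m σ) ≡ σ
decompose-∈ {n} {m} {d} 1≤m σ∈
  with σ-inv , σ-avoids , σ-max , σ-distinct ← ∈-𝔄⁻ {n} σ∈
  with α , β , refl , α≢m ← first-occurrence (proj₁ (maxSeq-≡⁻ σ-max))
  = subst (_∈ decompositions n m d) (sym decompose-σ) parts-∈-decompositions ,
    trans (cong (assemble m) decompose-σ) assemble-decompose
  where open Splitting {n} 1≤m α≢m σ-inv σ-avoids σ-max σ-distinct

length-decompositions : ∀ n m d → 1 ≤ m →
  length (decompositions n m d) ≡
    sumFromTo 0 (d ∸ 1) (λ i →
      ((m ∸ i) C (d ∸ i ∸ 1)) *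
        sumFromTo (m + 1) n (λ p →
          bCount (n ∸ p + 1) (d ∸ i) *
            sumFromTo 0 (m ∸ 1) (λ j → aCount (p ∸ 1) j i)))
length-decompositions n m d 1≤m =
  trans (length-⊗ (λ i → c i * sumFromTo (m + 1) n (λ p → b i p * S i p)) (λ {i} _ → per-i {i}))
        (sym (sumFromTo-range 0 (d ∸ 1) _))
  where
  open ≡-Reasoning
  c : ℕ → ℕ
  c i = (m ∸ i) C (d ∸ i ∸ 1)
  b : ℕ → ℕ → ℕ
  b i p = bCount (n ∸ p + 1) (d ∸ i)
  a : ℕ → ℕ → ℕ → ℕ
  a i p j = aCount (p ∸ 1) j i
  S : ℕ → ℕ → ℕ
  S i p = sumFromTo 0 (m ∸ 1) (a i p)

  per-α : ∀ {i p j α} → j < m → α ∈ 𝔄 (p ∸ 1) j i →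
    length (combinations (unusedBelow m α) (d ∸ i ∸ 1) ⊗ λ _ → 𝔅 (n ∸ p + 1) (d ∸ i)) ≡ c i * b i p
  per-α {i} {p} {j} {α} j<m α∈ with _ , _ , α-max , α-distinct ← ∈-𝔄⁻ {p ∸ 1} α∈ = begin
    length (combinations (unusedBelow m α) (d ∸ i ∸ 1) ⊗ _)
      ≡⟨ length-⊗-const (b i p) (λ _ → refl) ⟩
    length (combinations (unusedBelow m α) (d ∸ i ∸ 1)) * b i p
      ≡⟨ cong (_* b i p) (length-combinations (unusedBelow m α) (d ∸ i ∸ 1)) ⟩
    (length (unusedBelow m α) C (d ∸ i ∸ 1)) * b i p
      ≡⟨ cong (λ k → (k C (d ∸ i ∸ 1)) * b i p) |unused| ⟩
    c i * b i p ∎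
    where
    |unused| : length (unusedBelow m α) ≡ m ∸ i
    |unused| = trans (length-unusedBelow (maxSeq-<⁻ α-max j<m)) (cong (m ∸_) α-distinct)

  per-p : ∀ {i p} →
    length (range 0 (m ∸ 1) ⊗ λ j → 𝔄 (p ∸ 1) j i ⊗ λ α →
            combinations (unusedBelow m α) (d ∸ i ∸ 1) ⊗ λ _ → 𝔅 (n ∸ p + 1) (d ∸ i))
    ≡ c i * (b i p * S i p)
  per-p {i} {p} = begin
    length (range 0 (m ∸ 1) ⊗ _)
      ≡⟨ length-⊗ (λ j → c i * b i p * a i p j) per-j ⟩
    sum (map (λ j → c i * b i p * a i p j) (range 0 (m ∸ 1)))
      ≡⟨ sum-map-*ˡ (c i * b i p) (a i p) (range 0 (m ∸ 1)) ⟩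
    c i * b i p * sum (map (a i p) (range 0 (m ∸ 1)))
      ≡⟨ cong (c i * b i p *_) (sumFromTo-range 0 (m ∸ 1) (a i p)) ⟨
    c i * b i p * S i p
      ≡⟨ *-assoc (c i) (b i p) (S i p) ⟩
    c i * (b i p * S i p) ∎
    where
    per-j : ∀ {j} → j ∈ range 0 (m ∸ 1) → length (𝔄 (p ∸ 1) j i ⊗ _) ≡ c i * b i p * a i p j
    per-j {j} j∈ = trans (length-⊗-const (c i * b i p) (per-α {i} {p} j<m)) (*-comm (a i p j) (c i * b i p))
      where
      j<m : j < m
      j<m = ≤∸1⇒< 1≤m (proj₂ (∈-range⁻ {0} {m ∸ 1} j∈))

  per-i : ∀ {i} →
    length (range (m + 1) n ⊗ λ p → range 0 (m ∸ 1) ⊗ λ j → 𝔄 (p ∸ 1) j i ⊗ λ α →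
            combinations (unusedBelow m α) (d ∸ i ∸ 1) ⊗ λ _ → 𝔅 (n ∸ p + 1) (d ∸ i))
    ≡ c i * sumFromTo (m + 1) n (λ p → b i p * S i p)
  per-i {i} = begin
    length (range (m + 1) n ⊗ _)
      ≡⟨ length-⊗ (λ p → c i * (b i p * S i p)) (λ {p} _ → per-p {i} {p}) ⟩
    sum (map (λ p → c i * (b i p * S i p)) (range (m + 1) n))
      ≡⟨ sum-map-*ˡ (c i) (λ p → b i p * S i p) (range (m + 1) n) ⟩
    c i * sum (map (λ p → b i p * S i p) (range (m + 1) n))
      ≡⟨ cong (c i *_) (sumFromTo-range (m + 1) n _) ⟨
    c i * sumFromTo (m + 1) n (λ p → b i p * S i p) ∎

decompositions-unique : ∀ n m d → Unique (decompositions n m d)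
decompositions-unique n m d =
  ⊗-unique (range-unique 0 (d ∸ 1)) λ i →
  ⊗-unique (range-unique (m + 1) n) λ p →
  ⊗-unique (range-unique 0 (m ∸ 1)) λ j →
  ⊗-unique (Unique.filter⁺ _ (invSeqs-unique (p ∸ 1))) λ α →
  ⊗-unique (combinations-unique (d ∸ i ∸ 1) (Unique.filter⁺ (_∉? α) (Unique.upTo⁺ m))) λ _ →
  Unique.filter⁺ _ (words-unique (d ∸ i) (n ∸ p + 1))

theorem18 : (n m d : ℕ) → 2 ≤ d → d ≤ m + 1 → m + 1 ≤ n →
    aCount n m d ≡
      sumFromTo 0 (d ∸ 1) (λ i →
        ((m ∸ i) C (d ∸ i ∸ 1)) *
          sumFromTo (m + 1) n (λ p →
            bCount (n ∸ p + 1) (d ∸ i) *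
              sumFromTo 0 (m ∸ 1) (λ j → aCount (p ∸ 1) j i)))
theorem18 n m d 2≤d d≤m+1 _ = begin
  length (𝔄 n m d)
    ≡⟨ length-≡-by-inverses (Unique.filter⁺ _ (invSeqs-unique n)) (decompositions-unique n m d)
         (decompose m) (assemble m) (decompose-∈ 1≤m) (assemble-∈ 1≤d 1≤m) ⟩
  length (decompositions n m d)
    ≡⟨ length-decompositions n m d 1≤m ⟩
  _ ∎
  where
  open ≡-Reasoning
  1≤d : 1 ≤ d
  1≤d = ≤-trans (s≤s z≤n) 2≤d
  1≤m : 1 ≤ m
  1≤m = ≤-pred (subst (2 ≤_) (+-comm m 1) (≤-trans 2≤d d≤m+1))
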